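{- Let $F$ be a field, $A$ an associative $F$-algebra (not necessarily finite-dimensional) with two-sided identity $1_A \neq 0_A$, and $H$ an $F$-subspace of $A$ of codimension one. Suppose that either $U(A) \subseteq H$ or $U(A) \cap H = \emptyset$. Then $\mathrm{nil}(A) \subseteq H$.
   Context: $U(A)$ denotes the set of elements of $A$ having a two-sided multiplicative inverse; $\mathrm{nil}(A)$ denotes the set of nilpotent elements of $A$. -}

module Defs where

open import Level using (Level; _⊔_; suc)
open import Algebra.Bundles using (CommutativeRing; Ring)
open import Data.Nat using (ℕ; zero) renaming (suc to 1+)
open import Data.Product using (Σ; ∃; _×_)
open import Data.Sum using (_⊎_)
open import Relation.Nullary using (¬_)

-- A field: a commutative ring with 1 ≠ 0 in which every element is either
-- zero or invertible (the standard "discrete field" reading; classically this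
-- is exactly the usual definition of a field).
record IsField {c ℓ : Level} (F : CommutativeRing c ℓ) : Set (c ⊔ ℓ) where
  open CommutativeRing F
  field
    1≉0       : ¬ (1# ≈ 0#)
    zero-or-inv : ∀ x → (x ≈ 0#) ⊎ (∃ λ y → x * y ≈ 1#)

record Algebra {c ℓ : Level} (F : CommutativeRing c ℓ) (a ℓa : Level)
       : Set (c ⊔ ℓ ⊔ suc (a ⊔ ℓa)) where
  module F = CommutativeRing F
  field
    ring : Ring a ℓa
  open Ring ring public
  field
    _·_      : F.Carrier → Carrier → Carrier
    ·-cong   : ∀ {c d x y} → c F.≈ d → x ≈ y → (c · x) ≈ (d · y)
    ·-distribˡ : ∀ c x y → (c · (x + y)) ≈ ((c · x) + (c · y))
    ·-distribʳ : ∀ c d x → ((c F.+ d) · x) ≈ ((c · x) + (d · x))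
    ·-assoc  : ∀ c d x → ((c F.* d) · x) ≈ (c · (d · x))
    ·-identity : ∀ x → (F.1# · x) ≈ x
    ·-*-assocˡ : ∀ c x y → ((c · x) * y) ≈ (c · (x * y))
    ·-*-assocʳ : ∀ c x y → (x * (c · y)) ≈ (c · (x * y))

module _ {c ℓ a ℓa : Level} {F : CommutativeRing c ℓ} (A : Algebra F a ℓa) where
  open Algebra A

  record IsSubspace {h : Level} (H : Carrier → Set h) : Set (c ⊔ a ⊔ ℓa ⊔ h) where
    field
      resp  : ∀ {x y} → x ≈ y → H x → H y
      0∈    : H 0#
      +-closed : ∀ {x y} → H x → H y → H (x + y)
      ·-closed : ∀ k {x} → H x → H (k · x)

  -- H has codimension one: A/H is one-dimensional, i.e. spanned by the class
  -- of some v ∉ H.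
  HasCodimOne : {h : Level} → (Carrier → Set h) → Set (c ⊔ a ⊔ h)
  HasCodimOne H = ∃ λ v → ¬ H v × (∀ x → ∃ λ k → H (x - (k · v)))

  U : Carrier → Set (a ⊔ ℓa)
  U x = ∃ λ y → (x * y ≈ 1#) × (y * x ≈ 1#)

  pow : Carrier → ℕ → Carrier
  pow x zero = 1#
  pow x (1+ n) = x * pow x n

  nil : Carrier → Set ℓa
  nil x = ∃ λ n → pow x n ≈ 0#

-- If U(A) ⊆ H, then 1 ∈ H and, for nilpotent x, also 1 - x ∈ H (it is a unit with inverse
-- 1 + x + … + x^(n-1)), so x = 1 - (1 - x) ∈ H. If U(A) ∩ H = ∅, then 1 ∉ H, so A = H ⊕ F·1
-- and x ≡ m·1 modulo H. Were m ≠ 0, the unit 1 - m⁻¹x = -m⁻¹(x - m·1) would lie in H.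
module Submission where

open import Defs
open import Level using (Level)
open import Algebra.Bundles using (CommutativeRing; Ring; Semiring)
open import Data.Empty using (⊥-elim)
open import Data.Nat using (ℕ; zero; suc)
open import Data.Product using (∃; _×_; _,_)
open import Data.Sum using (_⊎_; inj₁; inj₂; [_,_])
open import Relation.Nullary using (¬_)
import Algebra.Definitions.RawSemiring as RawSemiringDefinitions
import Algebra.Properties.Ring as RingProperties
import Relation.Binary.Reasoning.Setoid as SetoidReasoning

module RingLemmas {r ℓr : Level} (R : Ring r ℓr) where
  open Ring R
  open RingProperties R
  open RawSemiringDefinitions (Semiring.rawSemiring semiring) using (_^_)
  open SetoidReasoning setoid

  y≈0⇒x-y≈x : ∀ {x y} → y ≈ 0# → x - y ≈ x
  y≈0⇒x-y≈x {x} y≈0 = trans (+-congˡ (trans (-‿cong y≈0) -0#≈0#)) (+-identityʳ x)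

  [x-y]+[y-z]≈x-z : ∀ x y z → (x - y) + (y - z) ≈ x - z
  [x-y]+[y-z]≈x-z x y z = begin
    (x - y) + (y - z)    ≈⟨ +-assoc x (- y) (y - z) ⟩
    x + (- y + (y - z))  ≈⟨ +-congˡ (\\-leftDividesʳ y (- z)) ⟩
    x - z                ∎

  [x-z]-[y-z]≈x-y : ∀ x y z → (x - z) - (y - z) ≈ x - y
  [x-z]-[y-z]≈x-y x y z = trans (+-congˡ (⁻¹-anti-homo‿- y z)) ([x-y]+[y-z]≈x-z x z y)

  x≈1-[1-x] : ∀ x → x ≈ 1# - (1# - x)
  x≈1-[1-x] x = sym (begin
    1# - (1# - x)   ≈⟨ +-congˡ (⁻¹-anti-homo‿- 1# x) ⟩
    1# + (x - 1#)   ≈⟨ +-assoc 1# x (- 1#) ⟨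
    1# + x - 1#     ≈⟨ xyx⁻¹≈y 1# x ⟩
    x               ∎)

  [1-x]x≈x[1-x] : ∀ x → (1# - x) * x ≈ x * (1# - x)
  [1-x]x≈x[1-x] x = begin
    (1# - x) * x     ≈⟨ [y-z]x≈yx-zx x 1# x ⟩
    1# * x - x * x   ≈⟨ +-congʳ (trans (*-identityˡ x) (sym (*-identityʳ x))) ⟩
    x * 1# - x * x   ≈⟨ x[y-z]≈xy-xz x 1# x ⟨
    x * (1# - x)     ∎

  geometricSum : Carrier → ℕ → Carrier
  geometricSum x zero    = 0#
  geometricSum x (suc n) = 1# + x * geometricSum x n

  geometricSum-step : ∀ x n → (1# - x) + x * (1# - x ^ n) ≈ 1# - x ^ suc n
  geometricSum-step x n = begin
    (1# - x) + x * (1# - x ^ n)        ≈⟨ +-congˡ (x[y-z]≈xy-xz x 1# (x ^ n)) ⟩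
    (1# - x) + (x * 1# - x * x ^ n)   ≈⟨ +-congˡ (+-congʳ (*-identityʳ x)) ⟩
    (1# - x) + (x - x ^ suc n)        ≈⟨ [x-y]+[y-z]≈x-z 1# x (x ^ suc n) ⟩
    1# - x ^ suc n                    ∎

  [1-x]geometricSum : ∀ x n → (1# - x) * geometricSum x n ≈ 1# - x ^ n
  [1-x]geometricSum x zero = trans (zeroʳ (1# - x)) (sym (-‿inverseʳ 1#))
  [1-x]geometricSum x (suc n) = begin
    (1# - x) * (1# + x * s)             ≈⟨ distribˡ (1# - x) 1# (x * s) ⟩
    (1# - x) * 1# + (1# - x) * (x * s)  ≈⟨ +-cong (*-identityʳ (1# - x)) (sym (*-assoc (1# - x) x s)) ⟩
    (1# - x) + ((1# - x) * x) * s       ≈⟨ +-congˡ (*-congʳ ([1-x]x≈x[1-x] x)) ⟩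
    (1# - x) + (x * (1# - x)) * s       ≈⟨ +-congˡ (*-assoc x (1# - x) s) ⟩
    (1# - x) + x * ((1# - x) * s)       ≈⟨ +-congˡ (*-congˡ ([1-x]geometricSum x n)) ⟩
    (1# - x) + x * (1# - x ^ n)         ≈⟨ geometricSum-step x n ⟩
    1# - x ^ suc n                      ∎
    where
    s : Carrier
    s = geometricSum x n

  geometricSum[1-x] : ∀ x n → geometricSum x n * (1# - x) ≈ 1# - x ^ n
  geometricSum[1-x] x zero = trans (zeroˡ (1# - x)) (sym (-‿inverseʳ 1#))
  geometricSum[1-x] x (suc n) = begin
    (1# + x * s) * (1# - x)             ≈⟨ distribʳ (1# - x) 1# (x * s) ⟩
    1# * (1# - x) + (x * s) * (1# - x)  ≈⟨ +-cong (*-identityˡ (1# - x)) (*-assoc x s (1# - x)) ⟩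
    (1# - x) + x * (s * (1# - x))       ≈⟨ +-congˡ (*-congˡ (geometricSum[1-x] x n)) ⟩
    (1# - x) + x * (1# - x ^ n)         ≈⟨ geometricSum-step x n ⟩
    1# - x ^ suc n                      ∎
    where
    s : Carrier
    s = geometricSum x n

  xⁿ≈0⇒1-x-invertible : ∀ {x} n → x ^ n ≈ 0# →
                         ∃ λ y → ((1# - x) * y ≈ 1#) × (y * (1# - x) ≈ 1#)
  xⁿ≈0⇒1-x-invertible {x} n xⁿ≈0 =
    geometricSum x n ,
    trans ([1-x]geometricSum x n) (y≈0⇒x-y≈x xⁿ≈0) ,
    trans (geometricSum[1-x] x n) (y≈0⇒x-y≈x xⁿ≈0)

module AlgebraLemmas {c ℓ a ℓa : Level} {F : CommutativeRing c ℓ} (A : Algebra F a ℓa) where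
  open Algebra A
  open RingProperties ring
  open RingLemmas ring
  open RawSemiringDefinitions (Semiring.rawSemiring F.semiring) using (_^_)
  open RawSemiringDefinitions (Semiring.rawSemiring semiring) using () renaming (_^_ to _^ᴬ_)
  open SetoidReasoning setoid

  ·-zeroˡ : ∀ x → F.0# · x ≈ 0#
  ·-zeroˡ x = x+x≈x⇒x≈0 (F.0# · x) (trans (sym (·-distribʳ F.0# F.0# x)) (·-cong (F.+-identityʳ F.0#) refl))

  ·-zeroʳ : ∀ k → k · 0# ≈ 0#
  ·-zeroʳ k = x+x≈x⇒x≈0 (k · 0#) (trans (sym (·-distribˡ k 0# 0#)) (·-cong F.refl (+-identityʳ 0#)))

  -‿distribˡ-· : ∀ k x → - (k · x) ≈ (F.- k) · x
  -‿distribˡ-· k x = sym (+-inverseʳ-unique (k · x) ((F.- k) · x)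
    (trans (sym (·-distribʳ k (F.- k) x)) (trans (·-cong (F.-‿inverseʳ k) refl) (·-zeroˡ x))))

  -‿distribʳ-· : ∀ k x → - (k · x) ≈ k · (- x)
  -‿distribʳ-· k x = sym (+-inverseʳ-unique (k · x) (k · (- x))
    (trans (sym (·-distribˡ k x (- x))) (trans (·-cong F.refl (-‿inverseʳ x)) (·-zeroʳ k))))

  k·[x-y]≈k·x-k·y : ∀ k x y → k · (x - y) ≈ k · x - k · y
  k·[x-y]≈k·x-k·y k x y = trans (·-distribˡ k x (- y)) (+-congˡ (sym (-‿distribʳ-· k y)))

  k'k≈1⇒k'·[k·x]≈x : ∀ {k k'} → k' F.* k F.≈ F.1# → ∀ x → k' · (k · x) ≈ x
  k'k≈1⇒k'·[k·x]≈x {k} {k'} k'k≈1 x = begin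
    k' · (k · x)     ≈⟨ ·-assoc k' k x ⟨
    (k' F.* k) · x   ≈⟨ ·-cong k'k≈1 refl ⟩
    F.1# · x         ≈⟨ ·-identity x ⟩
    x                ∎

  1∈U : U A 1#
  1∈U = 1# , *-identityˡ 1# , *-identityˡ 1#

  pow≈^ : ∀ x n → pow A x n ≈ x ^ᴬ n
  pow≈^ x zero    = refl
  pow≈^ x (suc n) = *-congˡ (pow≈^ x n)

  nil⇒U[1-x] : ∀ {x} → nil A x → U A (1# - x)
  nil⇒U[1-x] {x} (n , xⁿ≈0) = xⁿ≈0⇒1-x-invertible n (trans (sym (pow≈^ x n)) xⁿ≈0)

  pow-distrib-· : ∀ k x n → pow A (k · x) n ≈ (k ^ n) · pow A x n
  pow-distrib-· k x zero    = sym (·-identity 1#)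
  pow-distrib-· k x (suc n) = begin
    (k · x) * pow A (k · x) n          ≈⟨ *-congˡ (pow-distrib-· k x n) ⟩
    (k · x) * ((k ^ n) · pow A x n)    ≈⟨ ·-*-assocˡ k x _ ⟩
    k · (x * ((k ^ n) · pow A x n))    ≈⟨ ·-cong F.refl (·-*-assocʳ (k ^ n) x _) ⟩
    k · ((k ^ n) · (x * pow A x n))    ≈⟨ ·-assoc k (k ^ n) _ ⟨
    (k ^ suc n) · pow A x (suc n)      ∎

  nil-· : ∀ k {x} → nil A x → nil A (k · x)
  nil-· k {x} (n , xⁿ≈0) = n , trans (pow-distrib-· k x n) (trans (·-cong F.refl xⁿ≈0) (·-zeroʳ (k ^ n)))

module SubspaceLemmas {c ℓ a ℓa h : Level} {F : CommutativeRing c ℓ} (A : Algebra F a ℓa)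
                      {H : Algebra.Carrier A → Set h} (H-subspace : IsSubspace A H) where
  open Algebra A
  open IsSubspace H-subspace
  open RingProperties ring
  open RingLemmas ring
  open AlgebraLemmas A
  open SetoidReasoning setoid

  -‿closed : ∀ {x} → H x → H (- x)
  -‿closed {x} x∈H = resp (trans (sym (-‿distribˡ-· F.1# x)) (-‿cong (·-identity x))) (·-closed (F.- F.1#) x∈H)

  -closed : ∀ {x y} → H x → H y → H (x - y)
  -closed x∈H y∈H = +-closed x∈H (-‿closed y∈H)

  codimOne⇒spannedBy : IsField F → HasCodimOne A H → ∀ {w} → ¬ H w → ∀ x → ∃ λ m → H (x - m · w)
  codimOne⇒spannedBy isField (v , _ , coord) {w} w∉H x with coord w | coord x
  ... | k₀ , w-k₀·v∈H | k , x-k·v∈H with IsField.zero-or-inv isField k₀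
  ... | inj₁ k₀≈0 = ⊥-elim (w∉H (resp (y≈0⇒x-y≈x (trans (·-cong k₀≈0 refl) (·-zeroˡ v))) w-k₀·v∈H))
  ... | inj₂ (k₀⁻¹ , k₀k₀⁻¹≈1) = m , resp x-k·v-m·[w-k₀·v]≈x-m·w (-closed x-k·v∈H (·-closed m w-k₀·v∈H))
    where
    m : F.Carrier
    m = k F.* k₀⁻¹
    mk₀≈k : m F.* k₀ F.≈ k
    mk₀≈k = F.trans (F.*-assoc k k₀⁻¹ k₀)
                    (F.trans (F.*-congˡ (F.trans (F.*-comm k₀⁻¹ k₀) k₀k₀⁻¹≈1)) (F.*-identityʳ k))
    x-k·v-m·[w-k₀·v]≈x-m·w : (x - k · v) - m · (w - k₀ · v) ≈ x - m · w
    x-k·v-m·[w-k₀·v]≈x-m·w = begin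
      (x - k · v) - m · (w - k₀ · v)        ≈⟨ +-congˡ (-‿cong (k·[x-y]≈k·x-k·y m w (k₀ · v))) ⟩
      (x - k · v) - (m · w - m · (k₀ · v))  ≈⟨ +-congˡ (-‿cong (+-congˡ (-‿cong m·[k₀·v]≈k·v))) ⟩
      (x - k · v) - (m · w - k · v)         ≈⟨ [x-z]-[y-z]≈x-y x (m · w) (k · v) ⟩
      x - m · w                             ∎
      where
      m·[k₀·v]≈k·v : m · (k₀ · v) ≈ k · v
      m·[k₀·v]≈k·v = trans (sym (·-assoc m k₀ v)) (·-cong mk₀≈k refl)

  U⊆H⇒nil⊆H : (∀ x → U A x → H x) → ∀ x → nil A x → H x
  U⊆H⇒nil⊆H U⊆H x x∈nil =
    resp (sym (x≈1-[1-x] x)) (-closed (U⊆H 1# 1∈U) (U⊆H (1# - x) (nil⇒U[1-x] x∈nil)))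

  U∩H≡∅⇒nil⊆H : IsField F → HasCodimOne A H → (∀ x → U A x → ¬ H x) → ∀ x → nil A x → H x
  U∩H≡∅⇒nil⊆H isField codimOne U∩H≡∅ x x∈nil
    with codimOne⇒spannedBy isField codimOne (U∩H≡∅ 1# 1∈U) x
  ... | m , x-m·1∈H with IsField.zero-or-inv isField m
  ... | inj₁ m≈0 = resp (y≈0⇒x-y≈x (trans (·-cong m≈0 refl) (·-zeroˡ 1#))) x-m·1∈H
  ... | inj₂ (m⁻¹ , mm⁻¹≈1) =
    ⊥-elim (U∩H≡∅ (1# - y) (nil⇒U[1-x] (nil-· m⁻¹ x∈nil)) (resp -m⁻¹·[x-m·1]≈1-y (-‿closed (·-closed m⁻¹ x-m·1∈H))))
    where
    y : Carrier
    y = m⁻¹ · x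
    -m⁻¹·[x-m·1]≈1-y : - (m⁻¹ · (x - m · 1#)) ≈ 1# - y
    -m⁻¹·[x-m·1]≈1-y = begin
      - (m⁻¹ · (x - m · 1#))   ≈⟨ -‿cong (k·[x-y]≈k·x-k·y m⁻¹ x (m · 1#)) ⟩
      - (y - m⁻¹ · (m · 1#))   ≈⟨ -‿cong (+-congˡ (-‿cong (k'k≈1⇒k'·[k·x]≈x m⁻¹m≈1 1#))) ⟩
      - (y - 1#)               ≈⟨ ⁻¹-anti-homo‿- y 1# ⟩
      1# - y                   ∎
      where
      m⁻¹m≈1 : m⁻¹ F.* m F.≈ F.1#
      m⁻¹m≈1 = F.trans (F.*-comm m⁻¹ m) mm⁻¹≈1

lemma6 : {c ℓ a ℓa h : Level} (F : CommutativeRing c ℓ) → IsField F →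
         (A : Algebra F a ℓa) →
         ¬ (Algebra._≈_ A (Algebra.1# A) (Algebra.0# A)) →
         (H : Algebra.Carrier A → Set h) →
         IsSubspace A H → HasCodimOne A H →
         ((∀ x → U A x → H x) ⊎ (∀ x → U A x → ¬ H x)) →
         ∀ x → nil A x → H x
lemma6 F isField A _ H H-subspace codimOne = [ U⊆H⇒nil⊆H , U∩H≡∅⇒nil⊆H isField codimOne ]
  where open SubspaceLemmas A H-subspace
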